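{- Let $G$ be a strongly connected digraph with diameter at most $2$ that contains the pattern $\mathcal{F}_3$, i.e. there are four distinct vertices $u,v,w,z$ of $G$ such that $(u,z)$, $(u,v)$ and $(w,v)$ are arcs of $G$ and $(w,z)$ is not an arc of $G$. Then $I_2(G)=\langle 1\rangle$.
   Context: A digraph is simple: no loops and no multiple arcs. It is strongly connected if for all vertices $u,v$ there is a directed $uv$-walk. $\operatorname{dist}(u,v)$ is the number of arcs of a shortest directed $uv$-walk; the diameter is the maximum distance. $D_X(G)=\operatorname{diag}(x_u)_{u\in V(G)}+D(G)$, where $D(G)$ is the distance matrix and $x_u$ are indeterminates; $I_2(G)$ is the ideal of $\mathbb{Z}[x_u:u\in V(G)]$ generated by all $2\times 2$ minors of $D_X(G)$. Pairs of vertices not mentioned in the pattern are unconstrained. -}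

module Defs where

open import Data.Nat using (ℕ; zero; suc; _≤_)
open import Data.Fin using (Fin; _≟_)
open import Data.Integer as ℤ using (ℤ; +_)
open import Data.List using (List; []; _∷_)
open import Data.Product using (Σ; ∃; _×_; _,_)
open import Relation.Nullary using (¬_; yes; no)
open import Relation.Binary.PropositionalEquality using (_≡_)

-- A digraph on vertex set Fin n, given by its arc relation.
-- Simplicity: no loops (multiple arcs cannot occur with a relation).
record Digraph : Set₁ where
  field
    n      : ℕ
    Arc    : Fin n → Fin n → Set
    noLoop : ∀ u → ¬ Arc u u

open Digraph public

data Walk (G : Digraph) : Fin (n G) → Fin (n G) → ℕ → Set where
  here : ∀ {u} → Walk G u u zero
  step : ∀ {u w v k} → Arc G u w → Walk G w v k → Walk G u v (suc k)

StronglyConnected : Digraph → Set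
StronglyConnected G = ∀ u v → ∃ λ k → Walk G u v k

IsDistance : (G : Digraph) → (Fin (n G) → Fin (n G) → ℕ) → Set
IsDistance G d = ∀ u v → Walk G u v (d u v) × (∀ k → Walk G u v k → d u v ≤ k)

DiameterAtMost : (G : Digraph) → (Fin (n G) → Fin (n G) → ℕ) → ℕ → Set
DiameterAtMost G d m = ∀ u v → d u v ≤ m

ContainsF₃ : Digraph → Set
ContainsF₃ G = Σ (Fin (n G)) λ u → Σ (Fin (n G)) λ v →
               Σ (Fin (n G)) λ w → Σ (Fin (n G)) λ z →
  (¬ u ≡ v) × (¬ u ≡ w) × (¬ u ≡ z) × (¬ v ≡ w) × (¬ v ≡ z) × (¬ w ≡ z) ×
  Arc G u z × Arc G u v × Arc G w v × ¬ Arc G w z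

-- Polynomials in ℤ[x_0, …, x_{m-1}]: formal expressions, identified
-- when they define the same polynomial.  Since ℤ is an infinite integral
-- domain, two polynomial expressions are equal in ℤ[x] iff they agree
-- under every integer assignment of the variables.

data Poly (m : ℕ) : Set where
  var : Fin m → Poly m
  con : ℤ → Poly m
  _⊕_ : Poly m → Poly m → Poly m
  _⊗_ : Poly m → Poly m → Poly m
  ⊝_  : Poly m → Poly m

⟦_⟧ : ∀ {m} → Poly m → (Fin m → ℤ) → ℤ
⟦ var i ⟧ ρ = ρ i
⟦ con c ⟧ ρ = c
⟦ p ⊕ q ⟧ ρ = ⟦ p ⟧ ρ ℤ.+ ⟦ q ⟧ ρ
⟦ p ⊗ q ⟧ ρ = ⟦ p ⟧ ρ ℤ.* ⟦ q ⟧ ρ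
⟦ ⊝ p ⟧ ρ = ℤ.- ⟦ p ⟧ ρ

_≈P_ : ∀ {m} → Poly m → Poly m → Set
p ≈P q = ∀ ρ → ⟦ p ⟧ ρ ≡ ⟦ q ⟧ ρ

DX : ∀ {m} → (Fin m → Fin m → ℕ) → Fin m → Fin m → Poly m
DX d i j with i ≟ j
... | yes _ = var i ⊕ con (+ d i j)
... | no  _ = con (+ d i j)

minor : ∀ {m} → (Fin m → Fin m → ℕ) → Fin m → Fin m → Fin m → Fin m → Poly m
minor d i₁ i₂ j₁ j₂ =
  (DX d i₁ j₁ ⊗ DX d i₂ j₂) ⊕ (⊝ (DX d i₁ j₂ ⊗ DX d i₂ j₁))

MinorIndex : ℕ → Set
MinorIndex m = Fin m × Fin m × Fin m × Fin m

combo : ∀ {m} → (Fin m → Fin m → ℕ) → List (Poly m × MinorIndex m) → Poly m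
combo d [] = con (+ 0)
combo d ((c , (i₁ , i₂ , j₁ , j₂)) ∷ cs) =
  (c ⊗ minor d i₁ i₂ j₁ j₂) ⊕ combo d cs

InI₂ : ∀ {m} → (Fin m → Fin m → ℕ) → Poly m → Set
InI₂ {m} d p = Σ (List (Poly m × MinorIndex m)) λ cs → combo d cs ≈P p

I₂IsUnit : ∀ {m} → (Fin m → Fin m → ℕ) → Set
I₂IsUnit {m} d = ∀ (p : Poly m) → InI₂ d p

{-# OPTIONS --safe #-}
-- In the pattern F₃ the arcs give d(u,z) = d(u,v) = d(w,v) = 1, while the
-- missing arc wz together with diameter ≤ 2 forces d(w,z) = 2.  The 2×2 minor
-- of D_X(G) with rows u,w and columns z,v avoids the diagonal, so it is the
-- constant 1·1 − 1·2 = −1, a unit of ℤ[x]; hence I₂(G) = ⟨1⟩.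
module Submission where

open import Defs
open import Data.Nat using (ℕ; _≤_)
open import Data.Nat.Properties using (≤-antisym; ≤∧≢⇒<; n≢0⇒n>0)
open import Data.Fin using (Fin; _≟_)
open import Data.Integer as ℤ using (+_; -[1+_])
import Data.Integer.Properties as ℤ
open import Data.List using ([]; _∷_)
open import Data.Product using (_,_; proj₁; proj₂)
open import Relation.Nullary using (¬_; yes; no; contradiction)
open import Relation.Binary.PropositionalEquality

Walk-length-0⇒≡ : ∀ {G a b} → Walk G a b 0 → a ≡ b
Walk-length-0⇒≡ here = refl

Walk-length-1⇒Arc : ∀ {G a b} → Walk G a b 1 → Arc G a b
Walk-length-1⇒Arc (step a→b here) = a→b

module Distance (G : Digraph) {d : Fin (n G) → Fin (n G) → ℕ} (isDist : IsDistance G d) where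

  shortestWalk : ∀ a b → Walk G a b (d a b)
  shortestWalk a b = proj₁ (isDist a b)

  distance≢0 : ∀ {a b} → a ≢ b → d a b ≢ 0
  distance≢0 {a} {b} a≢b d≡0 = a≢b (Walk-length-0⇒≡ (subst (Walk G a b) d≡0 (shortestWalk a b)))

  distance≡1⇒Arc : ∀ {a b} → d a b ≡ 1 → Arc G a b
  distance≡1⇒Arc {a} {b} d≡1 = Walk-length-1⇒Arc (subst (Walk G a b) d≡1 (shortestWalk a b))

  Arc⇒distance≡1 : ∀ {a b} → a ≢ b → Arc G a b → d a b ≡ 1
  Arc⇒distance≡1 {a} {b} a≢b a→b =
    ≤-antisym (proj₂ (isDist a b) 1 (step a→b here)) (n≢0⇒n>0 (distance≢0 a≢b))

  ¬Arc⇒distance≡2 : ∀ {a b} → a ≢ b → ¬ Arc G a b → d a b ≤ 2 → d a b ≡ 2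
  ¬Arc⇒distance≡2 {a} {b} a≢b a↛b d≤2 = ≤-antisym d≤2 2≤d
    where
    2≤d : 2 ≤ d a b
    2≤d = ≤∧≢⇒< (n≢0⇒n>0 (distance≢0 a≢b)) (λ 1≡d → a↛b (distance≡1⇒Arc (sym 1≡d)))

module _ {m : ℕ} (d : Fin m → Fin m → ℕ) where

  DX-offDiagonal : ∀ {i j} → i ≢ j → DX d i j ≡ con (+ d i j)
  DX-offDiagonal {i} {j} i≢j with i ≟ j
  ... | yes i≡j = contradiction i≡j i≢j
  ... | no  _   = refl

  minor-offDiagonal : ∀ {i₁ i₂ j₁ j₂} →
    i₁ ≢ j₁ → i₂ ≢ j₂ → i₁ ≢ j₂ → i₂ ≢ j₁ →
    minor d i₁ i₂ j₁ j₂ ≈P con (+ d i₁ j₁ ℤ.* + d i₂ j₂ ℤ.- + d i₁ j₂ ℤ.* + d i₂ j₁)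
  minor-offDiagonal i₁≢j₁ i₂≢j₂ i₁≢j₂ i₂≢j₁ ρ
    rewrite DX-offDiagonal i₁≢j₁ | DX-offDiagonal i₂≢j₂
          | DX-offDiagonal i₁≢j₂ | DX-offDiagonal i₂≢j₁ = refl

  minor≈-1⇒I₂IsUnit : ∀ i₁ i₂ j₁ j₂ → minor d i₁ i₂ j₁ j₂ ≈P con -[1+ 0 ] → I₂IsUnit d
  minor≈-1⇒I₂IsUnit i₁ i₂ j₁ j₂ minor≈-1 p = (⊝ p , i₁ , i₂ , j₁ , j₂) ∷ [] , combo≈p
    where
    combo≈p : combo d ((⊝ p , i₁ , i₂ , j₁ , j₂) ∷ []) ≈P p
    combo≈p ρ = begin
      ℤ.- ⟦ p ⟧ ρ ℤ.* ⟦ minor d i₁ i₂ j₁ j₂ ⟧ ρ ℤ.+ + 0 ≡⟨ ℤ.+-identityʳ _ ⟩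
      ℤ.- ⟦ p ⟧ ρ ℤ.* ⟦ minor d i₁ i₂ j₁ j₂ ⟧ ρ          ≡⟨ cong (ℤ.- ⟦ p ⟧ ρ ℤ.*_) (minor≈-1 ρ) ⟩
      ℤ.- ⟦ p ⟧ ρ ℤ.* -[1+ 0 ]                           ≡⟨ ℤ.*-comm (ℤ.- ⟦ p ⟧ ρ) _ ⟩
      -[1+ 0 ] ℤ.* ℤ.- ⟦ p ⟧ ρ                           ≡⟨ ℤ.-1*i≡-i _ ⟩
      ℤ.- ℤ.- ⟦ p ⟧ ρ                                    ≡⟨ ℤ.neg-involutive _ ⟩
      ⟦ p ⟧ ρ                                            ∎
      where open ≡-Reasoning

lemma11 : (G : Digraph) → (d : Fin (n G) → Fin (n G) → ℕ) →
    StronglyConnected G → IsDistance G d → DiameterAtMost G d 2 →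
    ContainsF₃ G → I₂IsUnit d
lemma11 G d _ isDist diam (u , v , w , z , u≢v , _ , u≢z , v≢w , _ , w≢z , u→z , u→v , w→v , w↛z) =
  minor≈-1⇒I₂IsUnit d u w z v F₃-minor≈-1
  where
  open Distance G isDist

  F₃-minor≈-1 : minor d u w z v ≈P con -[1+ 0 ]
  F₃-minor≈-1 ρ = begin
    ⟦ minor d u w z v ⟧ ρ                                 ≡⟨ minor-offDiagonal d u≢z (≢-sym v≢w) u≢v w≢z ρ ⟩
    + d u z ℤ.* + d w v ℤ.- + d u v ℤ.* + d w z            ≡⟨ cong₂ ℤ._-_
                                                                (cong₂ ℤ._*_ (cong +_ (Arc⇒distance≡1 u≢z u→z))
                                                                             (cong +_ (Arc⇒distance≡1 (≢-sym v≢w) w→v)))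
                                                                (cong₂ ℤ._*_ (cong +_ (Arc⇒distance≡1 u≢v u→v))
                                                                             (cong +_ (¬Arc⇒distance≡2 w≢z w↛z (diam w z)))) ⟩
    + 1 ℤ.* + 1 ℤ.- + 1 ℤ.* + 2                            ≡⟨⟩
    -[1+ 0 ]                                               ∎
    where open ≡-Reasoning
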